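{- Let $\widetilde{G}$ be a positive mixed complete $k$-partite graph, one of whose partition classes contains exactly one vertex. If $k\ge3$ and $v\in V(\widetilde{G})$ lies in a partition class containing exactly one vertex, then $rk(\widetilde{G})=rk(\widetilde{G}-v)+1$.
   Context: A mixed graph is obtained from a simple graph (its underlying graph) by orienting some edges (arcs). Its Hermitian adjacency matrix $H=(h_{st})$ has $h_{st}=1$ for an undirected edge $v_sv_t$, $h_{st}=i$ for an arc from $v_s$ to $v_t$, $h_{st}=-i$ for an arc from $v_t$ to $v_s$, $0$ otherwise; $rk(\widetilde{G})$ is the rank of $H(\widetilde{G})$. A mixed complete $k$-partite graph is a mixed graph whose underlying graph is a complete $k$-partite graph. The value of a mixed cycle $u_1\cdots u_nu_1$ is $h_{u_1u_2}\cdots h_{u_nu_1}$; a mixed graph is positive if every mixed cycle has value $1$. $\widetilde{G}-v$ denotes the mixed graph obtained by deleting $v$ and its incident edges. -}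

module Defs where

open import Data.Nat using (ℕ; zero; suc; _≤_; _≥_)
open import Data.Fin using (Fin; zero; suc; inject₁; fromℕ; punchIn)
open import Data.Rational using (ℚ; 0ℚ; 1ℚ; -_) renaming (_+_ to _+q_; _*_ to _*q_; _-_ to _-q_)
open import Data.Product using (Σ; ∃; _×_; _,_)
open import Relation.Binary.PropositionalEquality using (_≡_; _≢_)
open import Relation.Nullary using (¬_)
open import Function.Definitions using (Injective; Surjective)

-- Gaussian rationals ℚ(i) : a + b i with a b ∈ ℚ (ℚ is normalised, so ≡ is equality)

record ℚi : Set where
  constructor _+i_
  field
    re : ℚ
    im : ℚ
open ℚi public

0i 1i iI -iI : ℚi
0i  = 0ℚ +i 0ℚ
1i  = 1ℚ +i 0ℚ
iI  = 0ℚ +i 1ℚ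
-iI = 0ℚ +i (- 1ℚ)

_⊕_ : ℚi → ℚi → ℚi
(a +i b) ⊕ (c +i d) = (a +q c) +i (b +q d)

_⊗_ : ℚi → ℚi → ℚi
(a +i b) ⊗ (c +i d) = ((a *q c) -q (b *q d)) +i ((a *q d) +q (b *q c))

∑ : ∀ {m} → (Fin m → ℚi) → ℚi
∑ {zero}  f = 0i
∑ {suc m} f = f zero ⊕ ∑ (λ j → f (suc j))

∏ : ∀ {m} → (Fin m → ℚi) → ℚi
∏ {zero}  f = 1i
∏ {suc m} f = f zero ⊗ ∏ (λ j → f (suc j))

-- Rank of a matrix  M : Fin n → Fin n → ℚi  (rows, columns)

Matrix : ℕ → Set
Matrix n = Fin n → Fin n → ℚi

IndependentCols : ∀ {n r} → Matrix n → (Fin r → Fin n) → Set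
IndependentCols {n} {r} M c =
  (a : Fin r → ℚi) → (∀ (s : Fin n) → ∑ (λ j → a j ⊗ M s (c j)) ≡ 0i) → ∀ j → a j ≡ 0i

IsRank : ∀ {n} → Matrix n → ℕ → Set
IsRank {n} M r =
  (Σ (Fin r → Fin n) λ c → Injective _≡_ _≡_ c × IndependentCols M c)
  × (∀ (c : Fin (suc r) → Fin n) → Injective _≡_ _≡_ c → ¬ IndependentCols M c)

data Arc : Set where
  none       : Arc
  undirected : Arc
  out        : Arc   -- arc from s to t
  inn        : Arc   -- arc from t to s

rev : Arc → Arc
rev none       = none
rev undirected = undirected
rev out        = inn
rev inn        = out

record MixedGraph (n : ℕ) : Set where
  field
    adj     : Fin n → Fin n → Arc
    loopless : ∀ s → adj s s ≡ none
    adj-rev  : ∀ s t → adj t s ≡ rev (adj s t)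
open MixedGraph public

arcEntry : Arc → ℚi
arcEntry none       = 0i
arcEntry undirected = 1i
arcEntry out        = iI
arcEntry inn        = -iI

H : ∀ {n} → MixedGraph n → Matrix n
H G s t = arcEntry (adj G s t)

IsRk : ∀ {n} → MixedGraph n → ℕ → Set
IsRk G r = IsRank (H G) r

deleteVertex : ∀ {n} → MixedGraph (suc n) → Fin (suc n) → MixedGraph n
deleteVertex G v = record
  { adj      = λ s t → adj G (punchIn v s) (punchIn v t)
  ; loopless = λ s → loopless G (punchIn v s)
  ; adj-rev  = λ s t → adj-rev G (punchIn v s) (punchIn v t)
  }

-- A mixed cycle u 0 u 1 … u m u 0 of length m+1 ≥ 3 : distinct vertices,
-- consecutive ones adjacent in the underlying graph.
record MixedCycle {n} (G : MixedGraph n) (m : ℕ) : Set where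
  field
    length≥3 : 2 ≤ m
    u        : Fin (suc m) → Fin n
    distinct : Injective _≡_ _≡_ u
    steps    : ∀ (j : Fin m) → adj G (u (inject₁ j)) (u (suc j)) ≢ none
    closing  : adj G (u (fromℕ m)) (u zero) ≢ none
open MixedCycle public

cycleValue : ∀ {n} {G : MixedGraph n} {m} → MixedCycle G m → ℚi
cycleValue {G = G} {m} C =
  ∏ (λ (j : Fin m) → H G (u C (inject₁ j)) (u C (suc j))) ⊗ H G (u C (fromℕ m)) (u C zero)

Positive : ∀ {n} → MixedGraph n → Set
Positive G = ∀ m (C : MixedCycle G m) → cycleValue C ≡ 1i

-- part assigns to each vertex its partition class; every class is nonempty,
-- and the underlying graph has an edge exactly between vertices in different classes.
IsCompleteMultipartite : ∀ {n} → MixedGraph n → (k : ℕ) → (Fin n → Fin k) → Set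
IsCompleteMultipartite {n} G k part =
  Surjective _≡_ _≡_ part
  × (∀ s t → (part s ≡ part t → adj G s t ≡ none) × (part s ≢ part t → adj G s t ≢ none))

SingletonClass : ∀ {n k} → (Fin n → Fin k) → Fin n → Set
SingletonClass part v = ∀ w → part w ≡ part v → w ≡ v

module Submission where

-- Every vertex other than v is adjacent to v, and positivity on the triangles through v gives
-- h_st = h_sv h_vt.  Hence H = D A D* with A the adjacency matrix of the underlying complete
-- multipartite graph and D = diag(h_sv) (with 1 at v) unitary.  Two vertices of one class then
-- have proportional columns, so the rank is at most the number k of classes, while one
-- representative per class spans the block D'(J - I)D'*, which is nonsingular as J - I has
-- eigenvalues k - 1 and -1.  So rk G = k, and G - v, again switched complete multipartite with
-- k - 1 ≥ 2 classes, has rank k - 1.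

open import Defs
open import Data.Nat using (ℕ; suc; _+_; _≥_)
open import Data.Fin using (Fin)
open import Relation.Binary.PropositionalEquality using (_≡_)

open import Level using (0ℓ)
open import Data.Nat as ℕ using (zero; s≤s)
import Data.Nat.Properties as ℕ
open import Data.Fin as Fin using (zero; suc; punchIn; punchOut; _≟_)
import Data.Fin.Properties as Fin
open import Data.Vec using ([]; _∷_; lookup)
open import Data.Vec.Relation.Unary.All using ([]; _∷_)
open import Data.Vec.Relation.Unary.AllPairs using ([]; _∷_)
open import Data.Vec.Relation.Unary.Unique.Propositional using (Unique)
open import Data.Vec.Relation.Unary.Unique.Propositional.Properties using (lookup-injective)
open import Data.Vec.Functional using (removeAt; replicate)
import Data.Vec.Functional as Vector
open import Data.Rational as ℚ using (0ℚ; 1ℚ; -_) renaming (_+_ to _+q_)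
import Data.Rational.Properties as ℚ
open import Data.Rational.Solver using (module +-*-Solver)
open +-*-Solver using (solve; _:+_; _:*_; _:-_; _:=_; con)
open import Data.Product using (Σ-syntax; _×_; _,_; proj₁; proj₂)
open import Function.Base using (_∘_)
open import Function.Definitions using (Injective; Surjective)
open import Relation.Nullary using (¬_; yes; no; contradiction)
open import Relation.Binary.Definitions using (tri<; tri≈; tri>)
open import Relation.Binary.PropositionalEquality
  using (_≢_; refl; sym; trans; cong; cong₂; isEquivalence; module ≡-Reasoning)
open import Algebra.Bundles using (CommutativeRing)
open import Algebra.Structures {A = ℚi} _≡_ using (IsCommutativeRing)
import Algebra.Definitions.RawMonoid as RawMonoid
open ≡-Reasoning

-ᵢ_ : ℚi → ℚi
-ᵢ (a +i b) = (- a) +i (- b)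

conj : ℚi → ℚi
conj (a +i b) = a +i (- b)

ℚi-isCommutativeRing : IsCommutativeRing _⊕_ _⊗_ -ᵢ_ 0i 1i
ℚi-isCommutativeRing = record
  { isRing = record
    { +-isAbelianGroup = record
      { isGroup = record
        { isMonoid = record
          { isSemigroup = record
            { isMagma = record { isEquivalence = isEquivalence ; ∙-cong = cong₂ _⊕_ }
            ; assoc = λ { (a +i b) (c +i d) (e +i f) → cong₂ _+i_ (ℚ.+-assoc a c e) (ℚ.+-assoc b d f) }
            }
          ; identity = (λ { (a +i b) → cong₂ _+i_ (ℚ.+-identityˡ a) (ℚ.+-identityˡ b) })
                     , (λ { (a +i b) → cong₂ _+i_ (ℚ.+-identityʳ a) (ℚ.+-identityʳ b) })
          }
        ; inverse = (λ { (a +i b) → cong₂ _+i_ (ℚ.+-inverseˡ a) (ℚ.+-inverseˡ b) })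
                  , (λ { (a +i b) → cong₂ _+i_ (ℚ.+-inverseʳ a) (ℚ.+-inverseʳ b) })
        ; ⁻¹-cong = cong -ᵢ_
        }
      ; comm = λ { (a +i b) (c +i d) → cong₂ _+i_ (ℚ.+-comm a c) (ℚ.+-comm b d) }
      }
    ; *-cong = cong₂ _⊗_
    ; *-assoc = λ { (a +i b) (c +i d) (e +i f) → cong₂ _+i_
        (solve 6 (λ a b c d e f → (a :* c :- b :* d) :* e :- (a :* d :+ b :* c) :* f
                                 := a :* (c :* e :- d :* f) :- b :* (c :* f :+ d :* e)) refl a b c d e f)
        (solve 6 (λ a b c d e f → (a :* c :- b :* d) :* f :+ (a :* d :+ b :* c) :* e
                                 := a :* (c :* f :+ d :* e) :+ b :* (c :* e :- d :* f)) refl a b c d e f) }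
    ; *-identity = (λ { (a +i b) → cong₂ _+i_
                       (solve 2 (λ a b → con 1ℚ :* a :- con 0ℚ :* b := a) refl a b)
                       (solve 2 (λ a b → con 1ℚ :* b :+ con 0ℚ :* a := b) refl a b) })
                 , (λ { (a +i b) → cong₂ _+i_
                       (solve 2 (λ a b → a :* con 1ℚ :- b :* con 0ℚ := a) refl a b)
                       (solve 2 (λ a b → a :* con 0ℚ :+ b :* con 1ℚ := b) refl a b) })
    ; distrib = (λ { (a +i b) (c +i d) (e +i f) → cong₂ _+i_
                    (solve 6 (λ a b c d e f → a :* (c :+ e) :- b :* (d :+ f)
                                             := (a :* c :- b :* d) :+ (a :* e :- b :* f)) refl a b c d e f)
                    (solve 6 (λ a b c d e f → a :* (d :+ f) :+ b :* (c :+ e)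
                                             := (a :* d :+ b :* c) :+ (a :* f :+ b :* e)) refl a b c d e f) })
              , (λ { (a +i b) (c +i d) (e +i f) → cong₂ _+i_
                    (solve 6 (λ a b c d e f → (c :+ e) :* a :- (d :+ f) :* b
                                             := (c :* a :- d :* b) :+ (e :* a :- f :* b)) refl a b c d e f)
                    (solve 6 (λ a b c d e f → (c :+ e) :* b :+ (d :+ f) :* a
                                             := (c :* b :+ d :* a) :+ (e :* b :+ f :* a)) refl a b c d e f) })
    }
  ; *-comm = λ { (a +i b) (c +i d) → cong₂ _+i_
      (solve 4 (λ a b c d → a :* c :- b :* d := c :* a :- d :* b) refl a b c d)
      (solve 4 (λ a b c d → a :* d :+ b :* c := c :* b :+ d :* a) refl a b c d) }
  }

ℚi-commutativeRing : CommutativeRing 0ℓ 0ℓ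
ℚi-commutativeRing = record { isCommutativeRing = ℚi-isCommutativeRing }

open CommutativeRing ℚi-commutativeRing
  using (semiring; ring; +-group; +-rawMonoid; *-commutativeMonoid; *-commutativeSemigroup;
         *-identityˡ; *-identityʳ; *-assoc; zeroˡ; zeroʳ; distribʳ; +-identityˡ; +-identityʳ; -‿inverseʳ)
open import Algebra.Properties.Semiring.Sum semiring
  using (sum; sum-cong-≗; sum-remove; sum-replicate; sum-replicate-zero; ∑-distrib-+; *-distribˡ-sum)
open import Algebra.Properties.Group +-group using (identityʳ-unique)
open import Algebra.Properties.Ring ring using (-1*x≈-x)
open import Algebra.Properties.CommutativeSemigroup *-commutativeSemigroup
  using (x∙yz≈y∙xz)
open import Algebra.Solver.CommutativeMonoid *-commutativeMonoid
  using (_⊜_) renaming (solve to ⊗-solve; _⊕_ to _⊛_)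
open RawMonoid +-rawMonoid using () renaming (_×_ to _×ᵢ_)
open RawMonoid ℚ.+-0-rawMonoid using () renaming (_×_ to _×ℚ_)

∑≡sum : ∀ {m} (f : Fin m → ℚi) → ∑ f ≡ sum f
∑≡sum {zero}  f = refl
∑≡sum {suc m} f = cong (f zero ⊕_) (∑≡sum (f ∘ suc))

×ℚ-pos : ∀ m a .{{_ : ℚ.Positive a}} → ℚ.Positive (suc m ×ℚ a)
×ℚ-pos zero    a = ℚ.pos+nonNeg⇒pos a 0ℚ
×ℚ-pos (suc m) a = ℚ.pos+pos⇒pos a (suc m ×ℚ a) {{×ℚ-pos m a}}

×ℚ-neg : ∀ m a .{{_ : ℚ.Negative a}} → ℚ.Negative (suc m ×ℚ a)
×ℚ-neg zero    a = ℚ.neg+nonPos⇒neg a 0ℚ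
×ℚ-neg (suc m) a = ℚ.neg+neg⇒neg a (suc m ×ℚ a) {{×ℚ-neg m a}}

×ℚ-≡0 : ∀ m a → suc m ×ℚ a ≡ 0ℚ → a ≡ 0ℚ
×ℚ-≡0 m a eq with ℚ.<-cmp a 0ℚ
... | tri< a<0 _ _ = contradiction (ℚ.negative⁻¹ _ {{×ℚ-neg m a {{ℚ.negative a<0}}}}) (ℚ.<-irrefl eq)
... | tri≈ _ a≡0 _ = a≡0
... | tri> _ _ a>0 = contradiction (ℚ.positive⁻¹ _ {{×ℚ-pos m a {{ℚ.positive a>0}}}}) (ℚ.<-irrefl (sym eq))

re-× : ∀ m x → re (m ×ᵢ x) ≡ m ×ℚ re x
re-× zero    x = refl
re-× (suc m) x = cong (re x +q_) (re-× m x)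

im-× : ∀ m x → im (m ×ᵢ x) ≡ m ×ℚ im x
im-× zero    x = refl
im-× (suc m) x = cong (im x +q_) (im-× m x)

×-≡0 : ∀ m x → suc m ×ᵢ x ≡ 0i → x ≡ 0i
×-≡0 m x eq = cong₂ _+i_ (×ℚ-≡0 m (re x) (trans (sym (re-× (suc m) x)) (cong re eq)))
                         (×ℚ-≡0 m (im x) (trans (sym (im-× (suc m) x)) (cong im eq)))


Unimodular : ℚi → Set
Unimodular x = conj x ⊗ x ≡ 1i

unimodular-cancelˡ : ∀ {x y} → Unimodular x → x ⊗ y ≡ 0i → y ≡ 0i
unimodular-cancelˡ {x} {y} unit xy≡0 = begin
  y                   ≡⟨ sym (*-identityˡ y) ⟩
  1i ⊗ y              ≡⟨ cong (_⊗ y) (sym unit) ⟩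
  (conj x ⊗ x) ⊗ y    ≡⟨ *-assoc (conj x) x y ⟩
  conj x ⊗ (x ⊗ y)    ≡⟨ cong (conj x ⊗_) xy≡0 ⟩
  conj x ⊗ 0i         ≡⟨ zeroʳ (conj x) ⟩
  0i                  ∎

unimodular-inverse : ∀ {x y} → Unimodular x → y ⊗ x ≡ 1i → y ≡ conj x
unimodular-inverse {x} {y} unit yx≡1 = begin
  y                   ≡⟨ sym (*-identityʳ y) ⟩
  y ⊗ 1i              ≡⟨ cong (y ⊗_) (sym unit) ⟩
  y ⊗ (conj x ⊗ x)    ≡⟨ x∙yz≈y∙xz y (conj x) x ⟩
  conj x ⊗ (y ⊗ x)    ≡⟨ cong (conj x ⊗_) yx≡1 ⟩
  conj x ⊗ 1i         ≡⟨ *-identityʳ (conj x) ⟩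
  conj x              ∎

single : ∀ {m} → Fin m → ℚi → Fin m → ℚi
single zero    x zero    = x
single zero    x (suc _) = 0i
single (suc i) x zero    = 0i
single (suc i) x (suc j) = single i x j

single-≢ : ∀ {m} {i j : Fin m} x → j ≢ i → single i x j ≡ 0i
single-≢ {i = zero}  {zero}  _ j≢i = contradiction refl j≢i
single-≢ {i = zero}  {suc j} _ _   = refl
single-≢ {i = suc i} {zero}  _ _   = refl
single-≢ {i = suc i} {suc j} x j≢i = single-≢ x (j≢i ∘ cong suc)

single-same : ∀ {m} (i : Fin m) x → single i x i ≡ x
single-same zero    x = refl
single-same (suc i) x = single-same i x

sum-single-⊗ : ∀ {m} (i : Fin m) x (f : Fin m → ℚi) → sum (λ t → single i x t ⊗ f t) ≡ x ⊗ f i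
sum-single-⊗ {suc m} zero x f = begin
  (x ⊗ f zero) ⊕ sum (λ t → 0i ⊗ f (suc t))  ≡⟨ cong ((x ⊗ f zero) ⊕_) (sum-cong-≗ (zeroˡ ∘ f ∘ suc)) ⟩
  (x ⊗ f zero) ⊕ sum (replicate m 0i)         ≡⟨ cong ((x ⊗ f zero) ⊕_) (sum-replicate-zero m) ⟩
  (x ⊗ f zero) ⊕ 0i                           ≡⟨ +-identityʳ (x ⊗ f zero) ⟩
  x ⊗ f zero                                  ∎
sum-single-⊗ (suc i) x f = begin
  (0i ⊗ f zero) ⊕ rest  ≡⟨ cong (_⊕ rest) (zeroˡ (f zero)) ⟩
  0i ⊕ rest             ≡⟨ +-identityˡ rest ⟩
  rest                  ≡⟨ sum-single-⊗ i x (f ∘ suc) ⟩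
  x ⊗ f (suc i)         ∎
  where
  rest : ℚi
  rest = sum (λ t → single i x t ⊗ f (suc t))

proportional⇒dependent : ∀ {N m} (M : Matrix N) (c : Fin m → Fin N) {i j : Fin m} → j ≢ i →
                         ∀ l → (∀ s → M s (c j) ≡ l ⊗ M s (c i)) → ¬ IndependentCols M c
proportional⇒dependent M c {i} {j} j≢i l proportional independent =
  -1≢0 (trans (sym a-j) (independent a combination≡0 j))
  where
  -1≢0 : -ᵢ 1i ≢ 0i
  -1≢0 ()
  a : Fin _ → ℚi
  a t = single i l t ⊕ single j (-ᵢ 1i) t
  a-j : a j ≡ -ᵢ 1i
  a-j = trans (cong₂ _⊕_ (single-≢ l j≢i) (single-same j (-ᵢ 1i))) (+-identityˡ (-ᵢ 1i))
  combination≡0 : ∀ s → ∑ (λ t → a t ⊗ M s (c t)) ≡ 0i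
  combination≡0 s = begin
    ∑ (λ t → a t ⊗ M s (c t))
      ≡⟨ ∑≡sum _ ⟩
    sum (λ t → a t ⊗ M s (c t))
      ≡⟨ sum-cong-≗ (λ t → distribʳ (M s (c t)) (single i l t) (single j (-ᵢ 1i) t)) ⟩
    sum (λ t → (single i l t ⊗ M s (c t)) ⊕ (single j (-ᵢ 1i) t ⊗ M s (c t)))
      ≡⟨ ∑-distrib-+ (λ t → single i l t ⊗ M s (c t)) (λ t → single j (-ᵢ 1i) t ⊗ M s (c t)) ⟩
    sum (λ t → single i l t ⊗ M s (c t)) ⊕ sum (λ t → single j (-ᵢ 1i) t ⊗ M s (c t))
      ≡⟨ cong₂ _⊕_ (sum-single-⊗ i l (M s ∘ c)) (sum-single-⊗ j (-ᵢ 1i) (M s ∘ c)) ⟩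
    (l ⊗ M s (c i)) ⊕ ((-ᵢ 1i) ⊗ M s (c j))
      ≡⟨ cong ((l ⊗ M s (c i)) ⊕_) (trans (-1*x≈-x (M s (c j))) (cong -ᵢ_ (proportional s))) ⟩
    (l ⊗ M s (c i)) ⊕ (-ᵢ (l ⊗ M s (c i)))
      ≡⟨ -‿inverseʳ (l ⊗ M s (c i)) ⟩
    0i ∎

HasIndependentCols : ∀ {n} → Matrix n → ℕ → Set
HasIndependentCols {n} M p = Σ[ c ∈ (Fin p → Fin n) ] Injective _≡_ _≡_ c × IndependentCols M c

dropFirstCol : ∀ {n p} {M : Matrix n} → HasIndependentCols M (suc p) → HasIndependentCols M p
dropFirstCol {M = M} (c , injective , independent) =
  c ∘ suc , Fin.suc-injective ∘ injective , λ a combination≡0 j → independent (0i Vector.∷ a) (extended a combination≡0) (suc j)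
  where
  extended : ∀ a → (∀ s → ∑ (λ t → a t ⊗ M s (c (suc t))) ≡ 0i) →
             ∀ s → ∑ (λ t → (0i Vector.∷ a) t ⊗ M s (c t)) ≡ 0i
  extended a combination≡0 s = trans (cong (_⊕ ∑ (λ t → a t ⊗ M s (c (suc t)))) (zeroˡ (M s (c zero))))
                                     (trans (+-identityˡ _) (combination≡0 s))

HasIndependentCols-≤′ : ∀ {n p q} {M : Matrix n} → p ℕ.≤′ q → HasIndependentCols M q → HasIndependentCols M p
HasIndependentCols-≤′         ℕ.≤′-refl        = λ cols → cols
HasIndependentCols-≤′ {M = M} (ℕ.≤′-step p≤′q) = HasIndependentCols-≤′ {M = M} p≤′q ∘ dropFirstCol {M = M}

IsRank-unique : ∀ {n r s} {M : Matrix n} → IsRank M r → IsRank M s → r ≡ s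
IsRank-unique {r = r} {s} {M} (r-cols , r-maximal) (s-cols , s-maximal) with ℕ.<-cmp r s
... | tri< r<s _ _ = let c , injective , independent = HasIndependentCols-≤′ {M = M} (ℕ.≤⇒≤′ r<s) s-cols
                     in contradiction independent (r-maximal c injective)
... | tri≈ _ r≡s _ = r≡s
... | tri> _ _ s<r = let c , injective , independent = HasIndependentCols-≤′ {M = M} (ℕ.≤⇒≤′ s<r) r-cols
                     in contradiction independent (s-maximal c injective)

arcEntry-rev : ∀ a → arcEntry (rev a) ≡ conj (arcEntry a)
arcEntry-rev none       = refl
arcEntry-rev undirected = refl
arcEntry-rev out        = refl
arcEntry-rev inn        = refl

rev≡none⇒≡none : ∀ {a} → rev a ≡ none → a ≡ none
rev≡none⇒≡none {none} _ = refl

arcEntry-unimodular : ∀ a → a ≢ none → Unimodular (arcEntry a)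
arcEntry-unimodular none       a≢none = contradiction refl a≢none
arcEntry-unimodular undirected _      = refl
arcEntry-unimodular out        _      = refl
arcEntry-unimodular inn        _      = refl

module _ {n} (G : MixedGraph n) where

  H-hermitian : ∀ s t → H G t s ≡ conj (H G s t)
  H-hermitian s t = trans (cong arcEntry (adj-rev G s t)) (arcEntry-rev (adj G s t))

  H-unimodular : ∀ {s t} → adj G s t ≢ none → Unimodular (H G s t)
  H-unimodular {s} {t} = arcEntry-unimodular (adj G s t)

  H-diagonal : ∀ s → H G s s ≡ 0i
  H-diagonal s = cong arcEntry (loopless G s)

  adjacent-sym : ∀ {s t} → adj G s t ≢ none → adj G t s ≢ none
  adjacent-sym {s} {t} s~t t~s = s~t (rev≡none⇒≡none (trans (sym (adj-rev G s t)) t~s))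

  adjacent⇒≢ : ∀ {s t} → adj G s t ≢ none → s ≢ t
  adjacent⇒≢ {s} s~s refl = s~s (loopless G s)

  triangle-value : Positive G → ∀ {x y z} → adj G x y ≢ none → adj G y z ≢ none → adj G z x ≢ none →
                   (H G x y ⊗ H G y z) ⊗ H G z x ≡ 1i
  triangle-value positive {x} {y} {z} x~y y~z z~x = begin
    (H G x y ⊗ H G y z) ⊗ H G z x         ≡⟨ cong (λ h → (H G x y ⊗ h) ⊗ H G z x) (sym (*-identityʳ (H G y z))) ⟩
    (H G x y ⊗ (H G y z ⊗ 1i)) ⊗ H G z x  ≡⟨ positive 2 xyz ⟩
    1i                                    ∎
    where
    xyz-unique : Unique (x ∷ y ∷ z ∷ [])
    xyz-unique = (adjacent⇒≢ x~y ∷ adjacent⇒≢ z~x ∘ sym ∷ []) ∷ (adjacent⇒≢ y~z ∷ []) ∷ [] ∷ []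
    xyz : MixedCycle G 2
    xyz = record { length≥3 = s≤s (s≤s ℕ.z≤n) ; u = lookup (x ∷ y ∷ z ∷ [])
                 ; distinct = lookup-injective xyz-unique _ _
                 ; steps = λ { zero → x~y ; (suc zero) → y~z } ; closing = z~x }

  triangle-rule : Positive G → ∀ {x y z} → adj G x y ≢ none → adj G y z ≢ none → adj G z x ≢ none →
                  H G x z ≡ H G x y ⊗ H G y z
  triangle-rule positive {x} {y} {z} x~y y~z z~x = begin
    H G x z               ≡⟨ H-hermitian z x ⟩
    conj (H G z x)        ≡⟨ sym (unimodular-inverse (H-unimodular z~x) (triangle-value positive x~y y~z z~x)) ⟩
    H G x y ⊗ H G y z     ∎

-- H G = D A D* with D = diag e and A the adjacency matrix of the underlying graph.
record Switching {n} (G : MixedGraph n) (e : Fin n → ℚi) : Set where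
  field
    unimodular : ∀ s → Unimodular (e s)
    entry      : ∀ s t → adj G s t ≢ none → H G s t ≡ e s ⊗ conj (e t)

module _ {n} (G : MixedGraph n) (v : Fin n) where

  weightTowards : Fin n → ℚi
  weightTowards s with s ≟ v
  ... | yes _ = 1i
  ... | no  _ = H G s v

  dominating⇒switching : Positive G → (∀ s → s ≢ v → adj G s v ≢ none) → Switching G weightTowards
  dominating⇒switching positive dominating = record { unimodular = unimodular ; entry = entry }
    where
    unimodular : ∀ s → Unimodular (weightTowards s)
    unimodular s with s ≟ v
    ... | yes _   = refl
    ... | no  s≢v = H-unimodular G (dominating s s≢v)
    entry : ∀ s t → adj G s t ≢ none → H G s t ≡ weightTowards s ⊗ conj (weightTowards t)
    entry s t s~t with s ≟ v | t ≟ v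
    ... | yes refl | yes refl = contradiction refl (adjacent⇒≢ G s~t)
    ... | yes refl | no  t≢v  = trans (H-hermitian G t v) (sym (*-identityˡ _))
    ... | no  s≢v  | yes refl = sym (*-identityʳ _)
    ... | no  s≢v  | no  t≢v  = begin
      H G s t
        ≡⟨ triangle-rule G positive (dominating s s≢v) (adjacent-sym G (dominating t t≢v)) (adjacent-sym G s~t) ⟩
      H G s v ⊗ H G v t
        ≡⟨ cong (H G s v ⊗_) (H-hermitian G t v) ⟩
      H G s v ⊗ conj (H G t v) ∎

switching-deleteVertex : ∀ {n} {G : MixedGraph (suc n)} {e} (v : Fin (suc n)) →
                         Switching G e → Switching (deleteVertex G v) (e ∘ punchIn v)
switching-deleteVertex v switching = record
  { unimodular = unimodular ∘ punchIn v
  ; entry      = λ s t → entry (punchIn v s) (punchIn v t)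
  }
  where open Switching switching

-- With b j = a j ē j and S = Σ b, row i of the system reads e i (S - b i) = 0, so every
-- b i equals S; then S = (m + 2) S forces S = 0.
clique-independent : ∀ {n m} {G : MixedGraph n} {e} → Switching G e →
                     (w : Fin (suc (suc m)) → Fin n) → (∀ i j → i ≢ j → adj G (w i) (w j) ≢ none) →
                     IndependentCols (H G) w
clique-independent {m = m} {G} {e} switching w clique a combination≡0 i = begin
  a i                               ≡⟨ sym (*-identityʳ (a i)) ⟩
  a i ⊗ 1i                          ≡⟨ cong (a i ⊗_) (sym (unimodular (w i))) ⟩
  a i ⊗ (conj (e (w i)) ⊗ e (w i))  ≡⟨ sym (*-assoc (a i) _ _) ⟩
  b i ⊗ e (w i)                     ≡⟨ cong (_⊗ e (w i)) (trans (b≡S i) S≡0) ⟩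
  0i ⊗ e (w i)                      ≡⟨ zeroˡ (e (w i)) ⟩
  0i                                ∎
  where
  open Switching switching
  b : Fin (suc (suc m)) → ℚi
  b j = a j ⊗ conj (e (w j))
  S : ℚi
  S = sum b
  row : ∀ i → sum (λ j → a j ⊗ H G (w i) (w j)) ≡ e (w i) ⊗ sum (removeAt b i)
  row i = begin
    sum (λ j → a j ⊗ H G (w i) (w j))
      ≡⟨ sum-remove {i = i} (λ j → a j ⊗ H G (w i) (w j)) ⟩
    (a i ⊗ H G (w i) (w i)) ⊕ sum (removeAt (λ j → a j ⊗ H G (w i) (w j)) i)
      ≡⟨ cong₂ _⊕_ (trans (cong (a i ⊗_) (H-diagonal G (w i))) (zeroʳ (a i))) (sum-cong-≗ off-diagonal) ⟩
    0i ⊕ sum (λ j → e (w i) ⊗ removeAt b i j)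
      ≡⟨ +-identityˡ _ ⟩
    sum (λ j → e (w i) ⊗ removeAt b i j)
      ≡⟨ sym (*-distribˡ-sum (e (w i)) (removeAt b i)) ⟩
    e (w i) ⊗ sum (removeAt b i) ∎
    where
    off-diagonal : ∀ j → a (punchIn i j) ⊗ H G (w i) (w (punchIn i j)) ≡ e (w i) ⊗ b (punchIn i j)
    off-diagonal j = trans (cong (a (punchIn i j) ⊗_) (entry _ _ (clique i (punchIn i j) (Fin.punchInᵢ≢i i j ∘ sym))))
                           (x∙yz≈y∙xz (a (punchIn i j)) (e (w i)) _)
  b≡S : ∀ i → b i ≡ S
  b≡S i = begin
    b i                        ≡⟨ sym (+-identityʳ (b i)) ⟩
    b i ⊕ 0i                   ≡⟨ cong (b i ⊕_) (sym (unimodular-cancelˡ {e (w i)} (unimodular (w i)) e∑≡0)) ⟩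
    b i ⊕ sum (removeAt b i)   ≡⟨ sym (sum-remove {i = i} b) ⟩
    S                          ∎
    where
    e∑≡0 : e (w i) ⊗ sum (removeAt b i) ≡ 0i
    e∑≡0 = trans (sym (row i)) (trans (sym (∑≡sum (λ j → a j ⊗ H G (w i) (w j)))) (combination≡0 (w i)))
  S≡0 : S ≡ 0i
  S≡0 = ×-≡0 m S (identityʳ-unique S (suc m ×ᵢ S) (begin
    S ⊕ (suc m ×ᵢ S)              ≡⟨ sym (sum-replicate (suc (suc m)) {S}) ⟩
    sum (replicate (suc (suc m)) S) ≡⟨ sum-cong-≗ (sym ∘ b≡S) ⟩
    S                             ∎))

module Multipartite {n k} {G : MixedGraph n} {part : Fin n → Fin k}
                    (multipartite : IsCompleteMultipartite G k part) where

  sameClass⇒nonadjacent : ∀ s t → part s ≡ part t → adj G s t ≡ none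
  sameClass⇒nonadjacent s t = proj₁ (proj₂ multipartite s t)

  differentClass⇒adjacent : ∀ s t → part s ≢ part t → adj G s t ≢ none
  differentClass⇒adjacent s t = proj₂ (proj₂ multipartite s t)

  representative : Fin k → Fin n
  representative j = proj₁ (proj₁ multipartite j)

  class-representative : ∀ j → part (representative j) ≡ j
  class-representative j = proj₂ (proj₁ multipartite j) refl

  sameClass⇒proportional : ∀ {e} → Switching G e → ∀ {x y} → part x ≡ part y →
                           ∀ s → H G s y ≡ (e x ⊗ conj (e y)) ⊗ H G s x
  sameClass⇒proportional {e} switching {x} {y} x≈y s with part s ≟ part x
  ... | yes s≈x = begin
    H G s y
      ≡⟨ cong arcEntry (sameClass⇒nonadjacent s y (trans s≈x x≈y)) ⟩
    0i
      ≡⟨ sym (zeroʳ (e x ⊗ conj (e y))) ⟩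
    (e x ⊗ conj (e y)) ⊗ 0i
      ≡⟨ cong (λ h → (e x ⊗ conj (e y)) ⊗ arcEntry h) (sym (sameClass⇒nonadjacent s x s≈x)) ⟩
    (e x ⊗ conj (e y)) ⊗ H G s x ∎
  ... | no s≉x = begin
    H G s y
      ≡⟨ entry s y (differentClass⇒adjacent s y (s≉x ∘ λ s≈y → trans s≈y (sym x≈y))) ⟩
    e s ⊗ conj (e y)
      ≡⟨ sym (*-identityʳ (e s ⊗ conj (e y))) ⟩
    (e s ⊗ conj (e y)) ⊗ 1i
      ≡⟨ cong ((e s ⊗ conj (e y)) ⊗_) (sym (unimodular x)) ⟩
    (e s ⊗ conj (e y)) ⊗ (conj (e x) ⊗ e x)
      ≡⟨ ⊗-solve 4 (λ a b c d → (a ⊛ b) ⊛ (c ⊛ d) ⊜ (d ⊛ b) ⊛ (a ⊛ c)) refl (e s) (conj (e y)) (conj (e x)) (e x) ⟩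
    (e x ⊗ conj (e y)) ⊗ (e s ⊗ conj (e x))
      ≡⟨ cong ((e x ⊗ conj (e y)) ⊗_) (sym (entry s x (differentClass⇒adjacent s x s≉x))) ⟩
    (e x ⊗ conj (e y)) ⊗ H G s x ∎
    where open Switching switching

multipartite-rank : ∀ {n K} {G : MixedGraph n} {part : Fin n → Fin (suc (suc K))} {e} →
                    IsCompleteMultipartite G (suc (suc K)) part → Switching G e → IsRk G (suc (suc K))
multipartite-rank {G = G} {part} {e} multipartite switching =
  (representative , representative-injective , clique-independent switching representative representatives-adjacent) ,
  λ c _ → let i , j , i<j , ci≈cj = Fin.pigeonhole (ℕ.n<1+n _) (part ∘ c) in
          proportional⇒dependent (H G) c (Fin.<⇒≢ i<j ∘ sym) (e (c i) ⊗ conj (e (c j)))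
                                 (sameClass⇒proportional switching ci≈cj)
  where
  open Multipartite {G = G} {part} multipartite
  classOf-representative : ∀ {i j} → part (representative i) ≡ part (representative j) → i ≡ j
  classOf-representative {i} {j} eq = trans (sym (class-representative i)) (trans eq (class-representative j))
  representative-injective : Injective _≡_ _≡_ representative
  representative-injective = classOf-representative ∘ cong part
  representatives-adjacent : ∀ i j → i ≢ j → adj G (representative i) (representative j) ≢ none
  representatives-adjacent i j i≢j = differentClass⇒adjacent _ _ (i≢j ∘ classOf-representative)

module Singleton {n k} {G : MixedGraph (suc n)} {part : Fin (suc n) → Fin (suc k)}
                 (multipartite : IsCompleteMultipartite G (suc k) part)
                 {v : Fin (suc n)} (singleton : SingletonClass part v) where

  open Multipartite {G = G} {part} multipartite

  dominating : ∀ s → s ≢ v → adj G s v ≢ none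
  dominating s s≢v = differentClass⇒adjacent s v (s≢v ∘ singleton s)

  otherClass : ∀ s → part v ≢ part (punchIn v s)
  otherClass s v≈s = Fin.punchInᵢ≢i v s (singleton (punchIn v s) (sym v≈s))

  classAfterDeleting : Fin n → Fin k
  classAfterDeleting s = punchOut (otherClass s)

  deleteVertex-multipartite : IsCompleteMultipartite (deleteVertex G v) k classAfterDeleting
  deleteVertex-multipartite = surjective , λ s t →
      sameClass⇒nonadjacent _ _ ∘ Fin.punchOut-injective (otherClass s) (otherClass t)
    , λ s≉t → differentClass⇒adjacent _ _ (s≉t ∘ Fin.punchOut-cong (part v))
    where
    surjective : Surjective _≡_ _≡_ classAfterDeleting
    surjective j = s , λ { refl → class-s }
      where
      w : Fin (suc n)
      w = representative (punchIn (part v) j)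
      v≢w : v ≢ w
      v≢w v≡w = Fin.punchInᵢ≢i (part v) j (trans (sym (class-representative _)) (cong part (sym v≡w)))
      s : Fin n
      s = punchOut v≢w
      class-s : classAfterDeleting s ≡ j
      class-s = trans (Fin.punchOut-cong (part v) (trans (cong part (Fin.punchIn-punchOut v≢w)) (class-representative _)))
                      (Fin.punchOut-punchIn (part v))

lemma3p5 : ∀ {n k} (G : MixedGraph (suc n)) (part : Fin (suc n) → Fin k)
    → IsCompleteMultipartite G k part
    → Positive G
    → k ≥ 3
    → (v : Fin (suc n)) → SingletonClass part v
    → ∀ r r' → IsRk G r → IsRk (deleteVertex G v) r'
    → r ≡ r' + 1
lemma3p5 {k = suc (suc (suc k))} G part multipartite positive (s≤s (s≤s (s≤s _))) v singleton r r' rank rank' = begin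
  r                  ≡⟨ IsRank-unique {M = H G} rank (multipartite-rank multipartite switching) ⟩
  suc (suc (suc k))  ≡⟨ ℕ.+-comm 1 (suc (suc k)) ⟩
  suc (suc k) + 1    ≡⟨ cong (_+ 1) (IsRank-unique {M = H (deleteVertex G v)}
                          (multipartite-rank deleteVertex-multipartite (switching-deleteVertex v switching)) rank') ⟩
  r' + 1             ∎
  where
  open Singleton {G = G} {part} multipartite singleton
  switching : Switching G (weightTowards G v)
  switching = dominating⇒switching G v positive dominating
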